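{- Let $F$ be a graph on $k$ vertices. Then for all graphs $G$ on more than $k$ vertices, \[\hom(F,G)=\sum_{H\,:\,|V(H)|\leq k}\hom(F,H)\,\mathrm{indsub}(H,G)\,(-1)^{k-|V(H)|}\binom{|V(G)|-|V(H)|-1}{k-|V(H)|},\] where the sum ranges over all isomorphism types of graphs $H$ on at most $k$ vertices.
   Context: $\hom(F,G)$ is the number of homomorphisms from $F$ to $G$; $\mathrm{indsub}(H,G)$ is the number of subsets $U\subseteq V(G)$ such that the induced subgraph $G[U]$ is isomorphic to $H$. -}

module Defs where

open import Data.Bool using (Bool; true; false; _∧_; if_then_else_; not)
open import Data.Nat using (ℕ; zero; suc)
open import Data.Fin using (Fin; zero; suc; _≟_)
open import Data.List using (List; []; _∷_; map; concatMap; allFin; length; filterᵇ; foldr)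
open import Data.Bool.ListAction using (all; any)
open import Data.Integer as ℤ using (ℤ)
open import Data.Vec using (Vec; []; _∷_; lookup)
import Data.Vec as V
open import Relation.Nullary.Decidable using (⌊_⌋)
open import Relation.Binary.PropositionalEquality using (_≡_)

record Graph : Set where
  field
    n      : ℕ
    adj    : Fin n → Fin n → Bool
    sym    : ∀ i j → adj i j ≡ adj j i
    irrefl : ∀ i → adj i i ≡ false
open Graph public

_⇒ᵇ_ : Bool → Bool → Bool
a ⇒ᵇ b = if a then b else true

_==ᵇ_ : Bool → Bool → Bool
true  ==ᵇ b = b
false ==ᵇ b = not b

consF : ∀ {k m} → Fin m → (Fin k → Fin m) → Fin (suc k) → Fin m
consF x f zero    = x
consF x f (suc i) = f i

allFuns : (k m : ℕ) → List (Fin k → Fin m)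
allFuns zero    m = (λ ()) ∷ []
allFuns (suc k) m = concatMap (λ f → map (λ x → consF x f) (allFin m)) (allFuns k m)

isHom : (F G : Graph) → (Fin (n F) → Fin (n G)) → Bool
isHom F G f = all (λ i → all (λ j → adj F i j ⇒ᵇ adj G (f i) (f j)) (allFin (n F))) (allFin (n F))

hom : Graph → Graph → ℕ
hom F G = length (filterᵇ (isHom F G) (allFuns (n F) (n G)))

isIsoMap : (H H' : Graph) → (Fin (n H) → Fin (n H')) → Bool
isIsoMap H H' f =
  all (λ i → all (λ j → (⌊ i ≟ j ⌋ ==ᵇ ⌊ f i ≟ f j ⌋) ∧ (adj H i j ==ᵇ adj H' (f i) (f j)))
                 (allFin (n H))) (allFin (n H))
  ∧ all (λ y → any (λ x → ⌊ f x ≟ y ⌋) (allFin (n H))) (allFin (n H'))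

isIso : Graph → Graph → Bool
isIso H H' = any (isIsoMap H H') (allFuns (n H) (n H'))

Subset : ℕ → Set
Subset m = Vec Bool m

allSubsets : (m : ℕ) → List (Subset m)
allSubsets zero    = [] ∷ []
allSubsets (suc m) = concatMap (λ U → (true ∷ U) ∷ (false ∷ U) ∷ []) (allSubsets m)

size : ∀ {m} → Subset m → ℕ
size []          = zero
size (true ∷ U)  = suc (size U)
size (false ∷ U) = size U

members : ∀ {m} → (U : Subset m) → Vec (Fin m) (size U)
members []          = []
members (true ∷ U)  = zero ∷ V.map suc (members U)
members (false ∷ U) = V.map suc (members U)

-- induced subgraph G[U], with vertices relabelled 0..|U|-1 in increasing order
induced : (G : Graph) → Subset (n G) → Graph
induced G U = record
  { n      = size U
  ; adj    = λ i j → adj G (lookup (members U) i) (lookup (members U) j)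
  ; sym    = λ i j → sym G (lookup (members U) i) (lookup (members U) j)
  ; irrefl = λ i → irrefl G (lookup (members U) i)
  }

indsub : Graph → Graph → ℕ
indsub H G = length (filterᵇ (λ U → isIso (induced G U) H) (allSubsets (n G)))

sumℤ : List ℤ → ℤ
sumℤ = foldr ℤ._+_ (ℤ.+ 0)

-- Sort the maps f : V(F) → V(G) by the vertex sets U ⊇ f(V(F)), each U carrying the weight
--   w(U) = [x^k] x^|U| (1 − x)^(|V(G) ∖ U| − 1),   where (1 − x)^(−1) = 1 + x + x² + ⋯ .
-- By the binomial theorem, for any T ⊆ V(G) the weights of all U ⊇ T add up to
--   [x^k] x^|T| (x + (1 − x))^(|V(G) ∖ T|) (1 − x)^(−1) = [x^k] x^|T| (1 − x)^(−1),
-- which is 1 when |T| ≤ k. Taking T = f(V(F)) counts every map exactly once, so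
-- hom(F,G) = Σ_U hom(F,G[U]) w(U). For |U| ≤ k < |V(G)| the weight is the signed binomial coefficient
-- of the statement and for |U| > k it vanishes; grouping the sets U by the isomorphism type of G[U]
-- gives the formula.
module Submission where

open import Defs hiding (sym)
open import Data.Bool using (Bool; true; false; _∧_)
open import Data.Bool.Properties using (∧-assoc; ∧-comm)
open import Data.Nat as ℕ using (ℕ; zero; suc; _≤_; _<_; _∸_; z≤n; s≤s; _≤?_)
import Data.Nat.Properties as ℕP
open import Data.Nat.Combinatorics using (_C_; nCk+nC[k+1]≡[n+1]C[k+1])
open import Data.Fin using (Fin; zero; suc; _≟_)
open import Data.Fin.Properties using (cantor-schröder-bernstein)
open import Data.Fin.Permutation using (permutation)
open import Data.Fin.Subset using (∁)
open import Data.List using (List; []; _∷_; map; concatMap; allFin; length; filterᵇ; _++_; tabulate)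
open import Data.List.Properties using (map-cong)
open import Data.List.Relation.Unary.All as All using (All; []; _∷_)
open import Data.Bool.ListAction using (and; all; any)
open import Data.Integer using (ℤ; +_; _+_; _*_; -_; _^_)
import Data.Integer.Properties as ℤP
open import Data.Integer.Tactic.RingSolver using (solve-∀)
open import Data.Vec as V using ([]; _∷_; lookup)
open import Data.Vec.Properties using (lookup-map)
open import Data.Product using (∃; _,_; proj₁; proj₂; _×_)
open import Function using (_∘_; Congruent)
open import Relation.Nullary using (yes; no)
open import Data.Empty using (⊥-elim)
open import Relation.Nullary.Decidable using (⌊_⌋; dec-true; isYes≗does)
open import Relation.Binary.PropositionalEquality
open import Algebra.Properties.Semiring.Sum ℤP.+-*-semiring using (sum; sum-cong-≗; sum-permute; *-distribˡ-sum)

private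
  variable
    A B : Set
    k m N : ℕ

sumOver : List A → (A → ℤ) → ℤ
sumOver xs w = sumℤ (map w xs)

infix 5 sumOver
syntax sumOver xs (λ x → w) = ∑[ x ∈ xs ] w

∑-cong : (xs : List A) {w v : A → ℤ} → (∀ x → w x ≡ v x) → ∑[ x ∈ xs ] w x ≡ ∑[ x ∈ xs ] v x
∑-cong []       eq = refl
∑-cong (x ∷ xs) eq = cong₂ _+_ (eq x) (∑-cong xs eq)

∑-congᴬ : {xs : List A} {w v : A → ℤ} → All (λ x → w x ≡ v x) xs → ∑[ x ∈ xs ] w x ≡ ∑[ x ∈ xs ] v x
∑-congᴬ []         = refl
∑-congᴬ (eq ∷ eqs) = cong₂ _+_ eq (∑-congᴬ eqs)

∑-++ : (xs ys : List A) (w : A → ℤ) → ∑[ x ∈ xs ++ ys ] w x ≡ (∑[ x ∈ xs ] w x) + (∑[ y ∈ ys ] w y)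
∑-++ []       ys w = sym (ℤP.+-identityˡ _)
∑-++ (x ∷ xs) ys w = trans (cong (_+_ (w x)) (∑-++ xs ys w)) (sym (ℤP.+-assoc (w x) _ _))

∑-concatMap : (f : A → List B) (xs : List A) (w : B → ℤ) →
              ∑[ y ∈ concatMap f xs ] w y ≡ ∑[ x ∈ xs ] ∑[ y ∈ f x ] w y
∑-concatMap f []       w = refl
∑-concatMap f (x ∷ xs) w = trans (∑-++ (f x) (concatMap f xs) w) (cong (_+_ (∑[ y ∈ f x ] w y)) (∑-concatMap f xs w))

∑-map : (g : A → B) (xs : List A) (w : B → ℤ) → ∑[ y ∈ map g xs ] w y ≡ ∑[ x ∈ xs ] w (g x)
∑-map g []       w = refl
∑-map g (x ∷ xs) w = cong (_+_ (w (g x))) (∑-map g xs w)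

∑-tabulate : (f : Fin k → A) (w : A → ℤ) → ∑[ x ∈ tabulate f ] w x ≡ sum (w ∘ f)
∑-tabulate {zero}  f w = refl
∑-tabulate {suc k} f w = cong (_+_ (w (f zero))) (∑-tabulate (f ∘ suc) w)

∑-allFin : (w : Fin k → ℤ) → ∑[ i ∈ allFin k ] w i ≡ sum w
∑-allFin = ∑-tabulate (λ i → i)

∑-distrib-+ : (xs : List A) (w v : A → ℤ) → ∑[ x ∈ xs ] (w x + v x) ≡ (∑[ x ∈ xs ] w x) + (∑[ x ∈ xs ] v x)
∑-distrib-+ []       w v = refl
∑-distrib-+ (x ∷ xs) w v =
  trans (cong (_+_ (w x + v x)) (∑-distrib-+ xs w v)) (interchange (w x) (v x) _ _)
  where
  interchange : ∀ a b c d → a + b + (c + d) ≡ a + c + (b + d)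
  interchange = solve-∀

*-distribˡ-∑ : (a : ℤ) (xs : List A) (w : A → ℤ) → a * (∑[ x ∈ xs ] w x) ≡ ∑[ x ∈ xs ] a * w x
*-distribˡ-∑ a []       w = ℤP.*-zeroʳ a
*-distribˡ-∑ a (x ∷ xs) w = trans (ℤP.*-distribˡ-+ a (w x) _) (cong (_+_ (a * w x)) (*-distribˡ-∑ a xs w))

*-distribʳ-∑ : (a : ℤ) (xs : List A) (w : A → ℤ) → (∑[ x ∈ xs ] w x) * a ≡ ∑[ x ∈ xs ] w x * a
*-distribʳ-∑ a xs w = trans (ℤP.*-comm _ a) (trans (*-distribˡ-∑ a xs w) (∑-cong xs (λ x → ℤP.*-comm a (w x))))

∑-zero : (xs : List A) → ∑[ x ∈ xs ] + 0 ≡ + 0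
∑-zero []       = refl
∑-zero (x ∷ xs) = trans (ℤP.+-identityˡ _) (∑-zero xs)

∑-comm : (xs : List A) (ys : List B) (w : A → B → ℤ) →
         ∑[ x ∈ xs ] ∑[ y ∈ ys ] w x y ≡ ∑[ y ∈ ys ] ∑[ x ∈ xs ] w x y
∑-comm []       ys w = sym (∑-zero ys)
∑-comm (x ∷ xs) ys w = trans (cong (_+_ (∑[ y ∈ ys ] w x y)) (∑-comm xs ys w)) (sym (∑-distrib-+ ys (w x) _))

𝟙 : Bool → ℤ
𝟙 true  = + 1
𝟙 false = + 0

𝟙-∧ : ∀ a b → 𝟙 (a ∧ b) ≡ 𝟙 a * 𝟙 b
𝟙-∧ true  b = sym (ℤP.*-identityˡ _)
𝟙-∧ false b = refl

𝟙*-cong : ∀ p {a b} → (p ≡ true → a ≡ b) → 𝟙 p * a ≡ 𝟙 p * b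
𝟙*-cong true  eq = cong (+ 1 *_) (eq refl)
𝟙*-cong false eq = refl

length-filterᵇ : (p : A → Bool) (xs : List A) → + length (filterᵇ p xs) ≡ ∑[ x ∈ xs ] 𝟙 (p x)
length-filterᵇ p []       = refl
length-filterᵇ p (x ∷ xs) with p x
... | true  = cong (_+_ (+ 1)) (length-filterᵇ p xs)
... | false = trans (length-filterᵇ p xs) (sym (ℤP.+-identityˡ _))

∑-𝟙*-const : (p : A → Bool) (w : A → ℤ) (c : ℤ) (xs : List A) → All (λ x → p x ≡ true → w x ≡ c) xs →
             ∑[ x ∈ xs ] 𝟙 (p x) * w x ≡ + length (filterᵇ p xs) * c
∑-𝟙*-const p w c xs eqs = begin
  ∑[ x ∈ xs ] 𝟙 (p x) * w x  ≡⟨ ∑-congᴬ (All.map (λ {x} → 𝟙*-cong (p x)) eqs) ⟩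
  ∑[ x ∈ xs ] 𝟙 (p x) * c    ≡⟨ *-distribʳ-∑ c xs (𝟙 ∘ p) ⟨
  (∑[ x ∈ xs ] 𝟙 (p x)) * c  ≡⟨ cong (_* c) (length-filterᵇ p xs) ⟨
  + length (filterᵇ p xs) * c ∎
  where open ≡-Reasoning

∑-allFuns-suc : (w : (Fin (suc k) → Fin m) → ℤ) →
                ∑[ f ∈ allFuns (suc k) m ] w f ≡ ∑[ f ∈ allFuns k m ] sum (λ x → w (consF x f))
∑-allFuns-suc {k} {m} w = trans (∑-concatMap _ (allFuns k m) w)
  (∑-cong (allFuns k m) (λ f → trans (∑-map (λ x → consF x f) (allFin m) w) (∑-allFin (λ x → w (consF x f)))))

valuesIn : (Fin N → Bool) → (Fin k → Fin N) → Bool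
valuesIn {k = zero}  P f = true
valuesIn {k = suc k} P f = P (f zero) ∧ valuesIn P (f ∘ suc)

valuesIn-const : (f : Fin k → Fin N) → valuesIn (λ _ → true) f ≡ true
valuesIn-const {zero}  f = refl
valuesIn-const {suc k} f = valuesIn-const (f ∘ suc)

-- A bijection e : Fin m → {y | P y}, expressed by its effect on sums.
Enumerates : (Fin m → Fin N) → (Fin N → Bool) → Set
Enumerates {m} {N} e P = ∀ (v : Fin N → ℤ) → sum (v ∘ e) ≡ sum (λ y → 𝟙 (P y) * v y)

∑-allFuns-∘ : (e : Fin m → Fin N) (P : Fin N → Bool) → Enumerates e P →
              (w : (Fin k → Fin N) → ℤ) → Congruent _≗_ _≡_ w →
              ∑[ g ∈ allFuns k m ] w (e ∘ g) ≡ ∑[ f ∈ allFuns k N ] 𝟙 (valuesIn P f) * w f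
∑-allFuns-∘ {k = zero} e P enum w w-cong =
  cong (_+ + 0) (trans (w-cong (λ ())) (sym (ℤP.*-identityˡ _)))
∑-allFuns-∘ {m} {N} {suc k} e P enum w w-cong = begin
  ∑[ g ∈ allFuns (suc k) m ] w (e ∘ g)
    ≡⟨ ∑-allFuns-suc (λ g → w (e ∘ g)) ⟩
  ∑[ g ∈ allFuns k m ] sum (λ x → w (e ∘ consF x g))
    ≡⟨ ∑-cong (allFuns k m) (λ g → sum-cong-≗ {m} (λ x → w-cong (λ { zero → refl ; (suc i) → refl }))) ⟩
  ∑[ g ∈ allFuns k m ] sum (λ x → w (consF (e x) (e ∘ g)))
    ≡⟨ ∑-cong (allFuns k m) (λ g → enum (λ y → w (consF y (e ∘ g)))) ⟩
  ∑[ g ∈ allFuns k m ] w′ (e ∘ g)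
    ≡⟨ ∑-allFuns-∘ e P enum w′ w′-cong ⟩
  ∑[ h ∈ allFuns k N ] 𝟙 (valuesIn P h) * w′ h
    ≡⟨ ∑-cong (allFuns k N) (λ h → trans (*-distribˡ-sum (𝟙 (valuesIn P h)) (λ y → 𝟙 (P y) * w (consF y h))) (sum-cong-≗ {N} (regroup h))) ⟩
  ∑[ h ∈ allFuns k N ] sum (λ y → 𝟙 (valuesIn P (consF y h)) * w (consF y h))
    ≡⟨ ∑-allFuns-suc (λ f → 𝟙 (valuesIn P f) * w f) ⟨
  ∑[ f ∈ allFuns (suc k) N ] 𝟙 (valuesIn P f) * w f ∎
  where
  open ≡-Reasoning
  w′ : (Fin k → Fin N) → ℤ
  w′ h = sum (λ y → 𝟙 (P y) * w (consF y h))
  w′-cong : Congruent _≗_ _≡_ w′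
  w′-cong h≗h′ = sum-cong-≗ (λ y → cong (𝟙 (P y) *_) (w-cong (λ { zero → refl ; (suc i) → h≗h′ i })))
  regroup : ∀ h y → 𝟙 (valuesIn P h) * (𝟙 (P y) * w (consF y h)) ≡ 𝟙 (valuesIn P (consF y h)) * w (consF y h)
  regroup h y = begin
    𝟙 (valuesIn P h) * (𝟙 (P y) * w (consF y h)) ≡⟨ rearrange (𝟙 (valuesIn P h)) (𝟙 (P y)) _ ⟩
    𝟙 (P y) * 𝟙 (valuesIn P h) * w (consF y h)   ≡⟨ cong (_* w (consF y h)) (𝟙-∧ (P y) (valuesIn P h)) ⟨
    𝟙 (valuesIn P (consF y h)) * w (consF y h)   ∎
    where
    rearrange : ∀ a b c → a * (b * c) ≡ b * a * c
    rearrange = solve-∀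

isHom-resp : (F G G′ : Graph) (f : Fin (n F) → Fin (n G)) (f′ : Fin (n F) → Fin (n G′)) →
             (∀ i j → adj G (f i) (f j) ≡ adj G′ (f′ i) (f′ j)) → isHom F G f ≡ isHom F G′ f′
isHom-resp F G G′ f f′ same-adj = cong and (map-cong (λ i → cong and (map-cong (λ j →
  cong (adj F i j ⇒ᵇ_) (same-adj i j)) (allFin (n F)))) (allFin (n F)))

isHom-cong : (F G : Graph) → Congruent _≗_ _≡_ (𝟙 ∘ isHom F G)
isHom-cong F G f≗g = cong 𝟙 (isHom-resp F G G _ _ (λ i j → cong₂ (adj G) (f≗g i) (f≗g j)))

members-enumerates : (U : Subset N) → Enumerates (lookup (members U)) (lookup U)
members-enumerates []          v = refl
members-enumerates (true ∷ U)  v = cong₂ _+_ (sym (ℤP.*-identityˡ (v zero)))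
  (trans (sum-cong-≗ (λ i → cong v (lookup-map i suc (members U)))) (members-enumerates U (v ∘ suc)))
members-enumerates (false ∷ U) v =
  trans (trans (sum-cong-≗ (λ i → cong v (lookup-map i suc (members U)))) (members-enumerates U (v ∘ suc)))
        (sym (ℤP.+-identityˡ _))

hom-induced : (F G : Graph) (U : Subset (n G)) →
              + hom F (induced G U) ≡ ∑[ f ∈ allFuns (n F) (n G) ] 𝟙 (valuesIn (lookup U) f) * 𝟙 (isHom F G f)
hom-induced F G U =
  trans (length-filterᵇ (isHom F (induced G U)) (allFuns (n F) (size U)))
        (∑-allFuns-∘ (lookup (members U)) (lookup U) (members-enumerates U) (𝟙 ∘ isHom F G) (isHom-cong F G))

record Iso (H H′ : Graph) : Set where
  field
    to       : Fin (n H) → Fin (n H′)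
    from     : Fin (n H′) → Fin (n H)
    to-from  : ∀ y → to (from y) ≡ y
    from-to  : ∀ x → from (to x) ≡ x
    adj-to   : ∀ i j → adj H i j ≡ adj H′ (to i) (to j)

∧-true : ∀ {a b} → a ∧ b ≡ true → a ≡ true × b ≡ true
∧-true {true} {true} refl = refl , refl

==ᵇ-true : ∀ {a b} → (a ==ᵇ b) ≡ true → a ≡ b
==ᵇ-true {true}  {true}  _ = refl
==ᵇ-true {false} {false} _ = refl

all-tabulate : (p : A → Bool) (f : Fin k → A) → all p (tabulate f) ≡ true → ∀ i → p (f i) ≡ true
all-tabulate {k = suc k} p f h zero    = proj₁ (∧-true h)
all-tabulate {k = suc k} p f h (suc i) = all-tabulate p (f ∘ suc) (proj₂ (∧-true h)) i

all-allFin : (p : Fin k → Bool) → all p (allFin k) ≡ true → ∀ i → p i ≡ true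
all-allFin p = all-tabulate p (λ i → i)

any-true : (p : A → Bool) (xs : List A) → any p xs ≡ true → ∃ λ x → p x ≡ true
any-true p (x ∷ xs) h with p x in eq
... | true  = x , eq
... | false = any-true p xs h

≟-true⇒≡ : (i j : Fin k) → ⌊ i ≟ j ⌋ ≡ true → i ≡ j
≟-true⇒≡ i j h with i ≟ j
... | yes i≡j = i≡j

≡⇒≟-true : {i j : Fin k} → i ≡ j → ⌊ i ≟ j ⌋ ≡ true
≡⇒≟-true {i = i} refl = trans (isYes≗does (i ≟ i)) (dec-true (i ≟ i) refl)

isIso⇒Iso : (H H′ : Graph) → isIso H H′ ≡ true → Iso H H′
isIso⇒Iso H H′ h = record { to = to ; from = from ; to-from = to-from ; from-to = from-to ; adj-to = adj-to }
  where
  witness : ∃ λ σ → isIsoMap H H′ σ ≡ true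
  witness = any-true (isIsoMap H H′) (allFuns (n H) (n H′)) h
  to : Fin (n H) → Fin (n H′)
  to = proj₁ witness
  entry : ∀ i j → (⌊ i ≟ j ⌋ ==ᵇ ⌊ to i ≟ to j ⌋) ≡ true × (adj H i j ==ᵇ adj H′ (to i) (to j)) ≡ true
  entry i j = ∧-true (all-allFin _ (all-allFin _ (proj₁ (∧-true (proj₂ witness))) i) j)
  adj-to : ∀ i j → adj H i j ≡ adj H′ (to i) (to j)
  adj-to i j = ==ᵇ-true (proj₂ (entry i j))
  to-injective : ∀ i j → to i ≡ to j → i ≡ j
  to-injective i j e = ≟-true⇒≡ i j (trans (==ᵇ-true (proj₁ (entry i j))) (≡⇒≟-true e))
  preimage : ∀ y → ∃ λ x → ⌊ to x ≟ y ⌋ ≡ true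
  preimage y = any-true _ (allFin (n H)) (all-allFin _ (proj₂ (∧-true (proj₂ witness))) y)
  from : Fin (n H′) → Fin (n H)
  from y = proj₁ (preimage y)
  to-from : ∀ y → to (from y) ≡ y
  to-from y = ≟-true⇒≡ _ _ (proj₂ (preimage y))
  from-to : ∀ x → from (to x) ≡ x
  from-to x = to-injective _ _ (to-from (to x))

isIso⇒n≡ : (H H′ : Graph) → isIso H H′ ≡ true → n H ≡ n H′
isIso⇒n≡ H H′ h = cantor-schröder-bernstein
  (λ {x} {y} e → trans (sym (from-to x)) (trans (cong from e) (from-to y)))
  (λ {x} {y} e → trans (sym (to-from x)) (trans (cong to e) (to-from y)))
  where open Iso (isIso⇒Iso H H′ h)

isIso⇒hom≡ : (F H H′ : Graph) → isIso H H′ ≡ true → hom F H ≡ hom F H′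
isIso⇒hom≡ F H H′ h = ℤP.+-injective (begin
  + hom F H
    ≡⟨ length-filterᵇ (isHom F H) (allFuns (n F) (n H)) ⟩
  ∑[ g ∈ allFuns (n F) (n H) ] 𝟙 (isHom F H g)
    ≡⟨ ∑-cong (allFuns (n F) (n H)) (λ g → cong 𝟙 (transport g)) ⟩
  ∑[ g ∈ allFuns (n F) (n H) ] 𝟙 (isHom F H′ (to ∘ g))
    ≡⟨ ∑-allFuns-∘ to (λ _ → true) to-enumerates (𝟙 ∘ isHom F H′) (isHom-cong F H′) ⟩
  ∑[ f ∈ allFuns (n F) (n H′) ] 𝟙 (valuesIn (λ _ → true) f) * 𝟙 (isHom F H′ f)
    ≡⟨ ∑-cong (allFuns (n F) (n H′)) (λ f → trans (cong (λ b → 𝟙 b * 𝟙 (isHom F H′ f)) (valuesIn-const f)) (ℤP.*-identityˡ _)) ⟩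
  ∑[ f ∈ allFuns (n F) (n H′) ] 𝟙 (isHom F H′ f)
    ≡⟨ length-filterᵇ (isHom F H′) (allFuns (n F) (n H′)) ⟨
  + hom F H′ ∎)
  where
  open ≡-Reasoning
  open Iso (isIso⇒Iso H H′ h)
  transport : ∀ g → isHom F H g ≡ isHom F H′ (to ∘ g)
  transport g = isHom-resp F H H′ g (to ∘ g) (λ i j → adj-to (g i) (g j))
  to-enumerates : Enumerates to (λ _ → true)
  to-enumerates v = trans (sym (sum-permute v (permutation to from to-from from-to)))
                          (sum-cong-≗ (λ y → sym (ℤP.*-identityˡ (v y))))

-- powCoeff a r = [x^r] (1 − x)^(a − 1), where a = 0 stands for (1 − x)^(−1) = ∑ x^r.
powCoeff : ℕ → ℕ → ℤ
powCoeff zero    r = + 1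
powCoeff (suc a) r = (- + 1) ^ r * + (a C r)

-- (1 − x)^a = (1 − x)^(a − 1) − x (1 − x)^(a − 1)
powCoeff-pascal : ∀ a r → powCoeff a r + powCoeff (suc a) (suc r) ≡ powCoeff a (suc r)
powCoeff-pascal zero    r = cong (_+_ (+ 1)) (ℤP.*-zeroʳ ((- + 1) ^ suc r))
powCoeff-pascal (suc a) r = begin
  s * + (a C r) + - + 1 * s * + (suc a C suc r)
    ≡⟨ cong (λ z → s * + (a C r) + - + 1 * s * + z) (nCk+nC[k+1]≡[n+1]C[k+1] a r) ⟨
  s * + (a C r) + - + 1 * s * (+ (a C r) + + (a C suc r))
    ≡⟨ cancel s (+ (a C r)) (+ (a C suc r)) ⟩
  - + 1 * s * + (a C suc r) ∎
  where
  open ≡-Reasoning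
  s : ℤ
  s = (- + 1) ^ r
  cancel : ∀ s b c → s * b + - + 1 * s * (b + c) ≡ - + 1 * s * c
  cancel = solve-∀

powCoeff-zero : ∀ a → powCoeff a 0 ≡ + 1
powCoeff-zero zero    = refl
powCoeff-zero (suc a) = refl

-- weight k a u = [x^k] x^u (1 − x)^(a − 1)
weight : ℕ → ℕ → ℕ → ℤ
weight k       a zero    = powCoeff a k
weight zero    a (suc u) = + 0
weight (suc k) a (suc u) = weight k a u

-- x^u (1 − x)^(a − 1) = x^(u + 1) (1 − x)^(a − 1) + x^u (1 − x)^a
weight-pascal : ∀ k a u → weight k a (suc u) + weight k (suc a) u ≡ weight k a u
weight-pascal zero    a zero    = trans (ℤP.+-identityˡ _) (trans (powCoeff-zero (suc a)) (sym (powCoeff-zero a)))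
weight-pascal (suc k) a zero    = powCoeff-pascal a k
weight-pascal zero    a (suc u) = refl
weight-pascal (suc k) a (suc u) = weight-pascal k a u

weight-zero : ∀ {k u} → u ≤ k → weight k 0 u ≡ + 1
weight-zero z≤n       = refl
weight-zero (s≤s u≤k) = weight-zero u≤k

weight-> : ∀ {k u} a → k < u → weight k a u ≡ + 0
weight-> a (s≤s z≤n)       = refl
weight-> a (s≤s (s≤s k<u)) = weight-> a (s≤s k<u)

weight-≤ : ∀ {k u} a → u ≤ k → weight k (suc a) u ≡ (- + 1) ^ (k ∸ u) * + (a C (k ∸ u))
weight-≤ a z≤n       = refl
weight-≤ a (s≤s u≤k) = weight-≤ a u≤k

_⊆ᵇ_ : Subset m → Subset m → Bool
[]      ⊆ᵇ []      = true
(t ∷ T) ⊆ᵇ (u ∷ U) = (t ⇒ᵇ u) ∧ (T ⊆ᵇ U)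

∑-allSubsets-suc : (w : Subset (suc m) → ℤ) →
                   ∑[ U ∈ allSubsets (suc m) ] w U ≡ ∑[ U ∈ allSubsets m ] (w (true ∷ U) + w (false ∷ U))
∑-allSubsets-suc {m} w = trans (∑-concatMap _ (allSubsets m) w)
  (∑-cong (allSubsets m) (λ U → cong (_+_ (w (true ∷ U))) (ℤP.+-identityʳ _)))

-- Each new element of the ground set either joins U, raising the second argument of g, or stays
-- outside, raising the first; the recurrence of g absorbs the choice.
∑-supersets : (g : ℕ → ℕ → ℤ) → (∀ a u → g a (suc u) + g (suc a) u ≡ g a u) →
              (T : Subset m) (a u : ℕ) →
              ∑[ U ∈ allSubsets m ] 𝟙 (T ⊆ᵇ U) * g (a ℕ.+ size (∁ U)) (u ℕ.+ size U) ≡ g a (u ℕ.+ size T)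
∑-supersets g pascal [] a u =
  trans (ℤP.+-identityʳ _) (trans (ℤP.*-identityˡ _) (cong (λ b → g b (u ℕ.+ 0)) (ℕP.+-identityʳ a)))
∑-supersets {suc m} g pascal (true ∷ T) a u = begin
  ∑[ U ∈ allSubsets (suc m) ] 𝟙 ((true ∷ T) ⊆ᵇ U) * g (a ℕ.+ size (∁ U)) (u ℕ.+ size U)
    ≡⟨ ∑-allSubsets-suc (summand (true ∷ T)) ⟩
  ∑[ U ∈ allSubsets m ] (𝟙 (T ⊆ᵇ U) * g (a ℕ.+ size (∁ U)) (u ℕ.+ suc (size U)) + + 0)
    ≡⟨ ∑-cong (allSubsets m) (λ U → trans (ℤP.+-identityʳ _)
         (cong (λ v → 𝟙 (T ⊆ᵇ U) * g (a ℕ.+ size (∁ U)) v) (ℕP.+-suc u (size U)))) ⟩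
  ∑[ U ∈ allSubsets m ] 𝟙 (T ⊆ᵇ U) * g (a ℕ.+ size (∁ U)) (suc u ℕ.+ size U)
    ≡⟨ ∑-supersets g pascal T a (suc u) ⟩
  g a (suc u ℕ.+ size T)
    ≡⟨ cong (g a) (ℕP.+-suc u (size T)) ⟨
  g a (u ℕ.+ suc (size T)) ∎
  where
  open ≡-Reasoning
  summand : Subset (suc m) → Subset (suc m) → ℤ
  summand T′ U = 𝟙 (T′ ⊆ᵇ U) * g (a ℕ.+ size (∁ U)) (u ℕ.+ size U)
∑-supersets {suc m} g pascal (false ∷ T) a u = begin
  ∑[ U ∈ allSubsets (suc m) ] 𝟙 ((false ∷ T) ⊆ᵇ U) * g (a ℕ.+ size (∁ U)) (u ℕ.+ size U)
    ≡⟨ ∑-allSubsets-suc (summand (false ∷ T)) ⟩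
  ∑[ U ∈ allSubsets m ] (𝟙 (T ⊆ᵇ U) * g (a ℕ.+ size (∁ U)) (u ℕ.+ suc (size U))
                         + 𝟙 (T ⊆ᵇ U) * g (a ℕ.+ suc (size (∁ U))) (u ℕ.+ size U))
    ≡⟨ ∑-cong (allSubsets m) (λ U → cong₂ (λ v b → 𝟙 (T ⊆ᵇ U) * g (a ℕ.+ size (∁ U)) v + 𝟙 (T ⊆ᵇ U) * g b (u ℕ.+ size U))
         (ℕP.+-suc u (size U)) (ℕP.+-suc a (size (∁ U)))) ⟩
  ∑[ U ∈ allSubsets m ] (𝟙 (T ⊆ᵇ U) * g (a ℕ.+ size (∁ U)) (suc u ℕ.+ size U)
                         + 𝟙 (T ⊆ᵇ U) * g (suc a ℕ.+ size (∁ U)) (u ℕ.+ size U))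
    ≡⟨ ∑-distrib-+ (allSubsets m) _ _ ⟩
  (∑[ U ∈ allSubsets m ] 𝟙 (T ⊆ᵇ U) * g (a ℕ.+ size (∁ U)) (suc u ℕ.+ size U))
    + (∑[ U ∈ allSubsets m ] 𝟙 (T ⊆ᵇ U) * g (suc a ℕ.+ size (∁ U)) (u ℕ.+ size U))
    ≡⟨ cong₂ _+_ (∑-supersets g pascal T a (suc u)) (∑-supersets g pascal T (suc a) u) ⟩
  g a (suc (u ℕ.+ size T)) + g (suc a) (u ℕ.+ size T)
    ≡⟨ pascal a (u ℕ.+ size T) ⟩
  g a (u ℕ.+ size T) ∎
  where
  open ≡-Reasoning
  summand : Subset (suc m) → Subset (suc m) → ℤ
  summand T′ U = 𝟙 (T′ ⊆ᵇ U) * g (a ℕ.+ size (∁ U)) (u ℕ.+ size U)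

subsetWeight : ℕ → Subset m → ℤ
subsetWeight k U = weight k (size (∁ U)) (size U)

∑-subsetWeight-⊇ : (T : Subset m) → size T ≤ k → ∑[ U ∈ allSubsets m ] 𝟙 (T ⊆ᵇ U) * subsetWeight k U ≡ + 1
∑-subsetWeight-⊇ {k = k} T T≤k = trans (∑-supersets (weight k) (weight-pascal k) T 0 0) (weight-zero T≤k)

size+size-∁ : (U : Subset m) → size U ℕ.+ size (∁ U) ≡ m
size+size-∁ []          = refl
size+size-∁ (true ∷ U)  = cong suc (size+size-∁ U)
size+size-∁ (false ∷ U) = trans (ℕP.+-suc (size U) _) (cong suc (size+size-∁ U))

size-∁ : (U : Subset m) → size (∁ U) ≡ m ∸ size U
size-∁ U = trans (sym (ℕP.m+n∸m≡n (size U) _)) (cong (_∸ size U) (size+size-∁ U))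

suc[m∸n∸1]≡m∸n : ∀ {m n} → n < m → suc (m ∸ n ∸ 1) ≡ m ∸ n
suc[m∸n∸1]≡m∸n {suc m} {zero}  _         = refl
suc[m∸n∸1]≡m∸n {suc m} {suc n} (s≤s n<m) = suc[m∸n∸1]≡m∸n n<m

signedBinomial : ℕ → ℕ → ℕ → ℤ
signedBinomial k m u = (- + 1) ^ (k ∸ u) * + ((m ∸ u ∸ 1) C (k ∸ u))

subsetWeight-≤ : (U : Subset m) → k < m → size U ≤ k → subsetWeight k U ≡ signedBinomial k m (size U)
subsetWeight-≤ {m} {k} U k<m U≤k =
  trans (cong (λ a → weight k a (size U)) ∁-size) (weight-≤ (m ∸ size U ∸ 1) U≤k)
  where
  ∁-size : size (∁ U) ≡ suc (m ∸ size U ∸ 1)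
  ∁-size = trans (size-∁ U) (sym (suc[m∸n∸1]≡m∸n (ℕP.≤-<-trans U≤k k<m)))

subsetWeight-> : (U : Subset m) → k < size U → subsetWeight k U ≡ + 0
subsetWeight-> U = weight-> (size (∁ U))

insert : Fin m → Subset m → Subset m
insert zero    (b ∷ T) = true ∷ T
insert (suc x) (b ∷ T) = b ∷ insert x T

image : (Fin k → Fin m) → Subset m
image {zero}  {m} f = V.replicate m false
image {suc k}     f = insert (f zero) (image (f ∘ suc))

∅-⊆ᵇ : (U : Subset m) → V.replicate m false ⊆ᵇ U ≡ true
∅-⊆ᵇ []      = refl
∅-⊆ᵇ (u ∷ U) = ∅-⊆ᵇ U

insert-⊆ᵇ : (x : Fin m) (T U : Subset m) → insert x T ⊆ᵇ U ≡ lookup U x ∧ (T ⊆ᵇ U)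
insert-⊆ᵇ zero    (true  ∷ T) (true  ∷ U) = refl
insert-⊆ᵇ zero    (false ∷ T) (true  ∷ U) = refl
insert-⊆ᵇ zero    (t     ∷ T) (false ∷ U) = refl
insert-⊆ᵇ (suc x) (t ∷ T) (u ∷ U) = begin
  (t ⇒ᵇ u) ∧ (insert x T ⊆ᵇ U)      ≡⟨ cong ((t ⇒ᵇ u) ∧_) (insert-⊆ᵇ x T U) ⟩
  (t ⇒ᵇ u) ∧ (lookup U x ∧ (T ⊆ᵇ U)) ≡⟨ ∧-assoc (t ⇒ᵇ u) _ _ ⟨
  ((t ⇒ᵇ u) ∧ lookup U x) ∧ (T ⊆ᵇ U) ≡⟨ cong (_∧ (T ⊆ᵇ U)) (∧-comm (t ⇒ᵇ u) _) ⟩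
  (lookup U x ∧ (t ⇒ᵇ u)) ∧ (T ⊆ᵇ U) ≡⟨ ∧-assoc (lookup U x) _ _ ⟩
  lookup U x ∧ ((t ⇒ᵇ u) ∧ (T ⊆ᵇ U)) ∎
  where open ≡-Reasoning

valuesIn-image : (f : Fin k → Fin m) (U : Subset m) → valuesIn (lookup U) f ≡ image f ⊆ᵇ U
valuesIn-image {zero}  f U = sym (∅-⊆ᵇ U)
valuesIn-image {suc k} f U =
  trans (cong (lookup U (f zero) ∧_) (valuesIn-image (f ∘ suc) U)) (sym (insert-⊆ᵇ (f zero) _ U))

size-insert : (x : Fin m) (T : Subset m) → size (insert x T) ≤ suc (size T)
size-insert zero    (true  ∷ T) = ℕP.n≤1+n _
size-insert zero    (false ∷ T) = ℕP.≤-refl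
size-insert (suc x) (true  ∷ T) = s≤s (size-insert x T)
size-insert (suc x) (false ∷ T) = size-insert x T

size-∅ : ∀ m → size (V.replicate m false) ≡ 0
size-∅ zero    = refl
size-∅ (suc m) = size-∅ m

size-image : (f : Fin k → Fin m) → size (image f) ≤ k
size-image {zero}  {m} f = ℕP.≤-reflexive (size-∅ m)
size-image {suc k}     f = ℕP.≤-trans (size-insert (f zero) _) (s≤s (size-image (f ∘ suc)))

∑-subsetWeight-valuesIn : (f : Fin k → Fin m) →
                          ∑[ U ∈ allSubsets m ] 𝟙 (valuesIn (lookup U) f) * subsetWeight k U ≡ + 1
∑-subsetWeight-valuesIn {m = m} f =
  trans (∑-cong (allSubsets m) (λ U → cong (λ b → 𝟙 b * _) (valuesIn-image f U)))
        (∑-subsetWeight-⊇ (image f) (size-image f))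

hom≡∑-induced : (F G : Graph) →
                + hom F G ≡ ∑[ U ∈ allSubsets (n G) ] + hom F (induced G U) * subsetWeight (n F) U
hom≡∑-induced F G = begin
  + hom F G
    ≡⟨ length-filterᵇ (isHom F G) Fs ⟩
  ∑[ f ∈ Fs ] h f
    ≡⟨ ∑-cong Fs (λ f → trans (cong (h f *_) (∑-subsetWeight-valuesIn f)) (ℤP.*-identityʳ (h f))) ⟨
  ∑[ f ∈ Fs ] h f * (∑[ U ∈ Us ] 𝟙 (valuesIn (lookup U) f) * w U)
    ≡⟨ ∑-cong Fs (λ f → *-distribˡ-∑ (h f) Us _) ⟩
  ∑[ f ∈ Fs ] ∑[ U ∈ Us ] h f * (𝟙 (valuesIn (lookup U) f) * w U)
    ≡⟨ ∑-comm Fs Us _ ⟩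
  ∑[ U ∈ Us ] ∑[ f ∈ Fs ] h f * (𝟙 (valuesIn (lookup U) f) * w U)
    ≡⟨ ∑-cong Us (λ U → ∑-cong Fs (λ f → rearrange (h f) (𝟙 (valuesIn (lookup U) f)) (w U))) ⟩
  ∑[ U ∈ Us ] ∑[ f ∈ Fs ] 𝟙 (valuesIn (lookup U) f) * h f * w U
    ≡⟨ ∑-cong Us (λ U → *-distribʳ-∑ (w U) Fs _) ⟨
  ∑[ U ∈ Us ] (∑[ f ∈ Fs ] 𝟙 (valuesIn (lookup U) f) * h f) * w U
    ≡⟨ ∑-cong Us (λ U → cong (_* w U) (hom-induced F G U)) ⟨
  ∑[ U ∈ Us ] + hom F (induced G U) * w U ∎
  where
  open ≡-Reasoning
  Fs = allFuns (n F) (n G)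
  Us = allSubsets (n G)
  w : Subset (n G) → ℤ
  w = subsetWeight (n F)
  h : (Fin (n F) → Fin (n G)) → ℤ
  h = 𝟙 ∘ isHom F G
  rearrange : ∀ a b c → a * (b * c) ≡ b * a * c
  rearrange = solve-∀

module _ (Hs : List Graph) (small : All (λ H → n H ≤ k) Hs)
         (x : Graph → ℤ) (x-invariant : ∀ A B → isIso A B ≡ true → x A ≡ x B) where

  ∑-isIso-≤ : (A : Graph) → length (filterᵇ (isIso A) Hs) ≡ 1 →
              ∑[ H ∈ Hs ] 𝟙 (isIso A H) * x H ≡ x A
  ∑-isIso-≤ A once = begin
    ∑[ H ∈ Hs ] 𝟙 (isIso A H) * x H       ≡⟨ ∑-𝟙*-const (isIso A) x (x A) Hs (All.universal (λ H e → sym (x-invariant A H e)) Hs) ⟩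
    + length (filterᵇ (isIso A) Hs) * x A ≡⟨ cong (λ l → + l * x A) once ⟩
    + 1 * x A                             ≡⟨ ℤP.*-identityˡ (x A) ⟩
    x A                                   ∎
    where open ≡-Reasoning

  ∑-isIso-> : (A : Graph) → k < n A → ∑[ H ∈ Hs ] 𝟙 (isIso A H) * x H ≡ + 0
  ∑-isIso-> A k<A = trans (∑-𝟙*-const (isIso A) x (+ 0) Hs (All.map too-small small)) (ℤP.*-zeroʳ (+ length (filterᵇ (isIso A) Hs)))
    where
    too-small : ∀ {H} → n H ≤ k → isIso A H ≡ true → x H ≡ + 0
    too-small {H} H≤k e = ⊥-elim (ℕP.<⇒≱ k<A (subst (_≤ k) (sym (isIso⇒n≡ A H e)) H≤k))

lemma24 : (F G : Graph) → n F < n G →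
          (Hs : List Graph) → All (λ H → n H ≤ n F) Hs →
          (∀ H → n H ≤ n F → length (filterᵇ (isIso H) Hs) ≡ 1) →
          + hom F G ≡
            sumℤ (map (λ H → + hom F H * + indsub H G * (- + 1) ^ (n F ∸ n H)
                                         * + ((n G ∸ n H ∸ 1) C (n F ∸ n H))) Hs)
lemma24 F G F<G Hs small representatives = begin
  + hom F G
    ≡⟨ hom≡∑-induced F G ⟩
  ∑[ U ∈ Us ] + hom F (induced G U) * subsetWeight (n F) U
    ≡⟨ ∑-cong Us by-type ⟩
  ∑[ U ∈ Us ] ∑[ H ∈ Hs ] 𝟙 (isIso (induced G U) H) * x H
    ≡⟨ ∑-comm Us Hs _ ⟩
  ∑[ H ∈ Hs ] ∑[ U ∈ Us ] 𝟙 (isIso (induced G U) H) * x H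
    ≡⟨ ∑-cong Hs (λ H → trans (cong (_* x H) (length-filterᵇ _ Us)) (*-distribʳ-∑ (x H) Us _)) ⟨
  ∑[ H ∈ Hs ] + indsub H G * x H
    ≡⟨ ∑-cong Hs (λ H → rearrange (+ indsub H G) (+ hom F H) _ _) ⟩
  ∑[ H ∈ Hs ] + hom F H * + indsub H G * (- + 1) ^ (n F ∸ n H) * + ((n G ∸ n H ∸ 1) C (n F ∸ n H)) ∎
  where
  open ≡-Reasoning
  Us = allSubsets (n G)
  x : Graph → ℤ
  x H = + hom F H * signedBinomial (n F) (n G) (n H)
  x-invariant : ∀ A B → isIso A B ≡ true → x A ≡ x B
  x-invariant A B e = cong₂ (λ h u → + h * signedBinomial (n F) (n G) u) (isIso⇒hom≡ F A B e) (isIso⇒n≡ A B e)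
  by-type : ∀ U → + hom F (induced G U) * subsetWeight (n F) U ≡ ∑[ H ∈ Hs ] 𝟙 (isIso (induced G U) H) * x H
  by-type U with size U ≤? n F
  ... | yes U≤F = trans (cong (_*_ (+ hom F (induced G U))) (subsetWeight-≤ U F<G U≤F))
                        (sym (∑-isIso-≤ Hs small x x-invariant (induced G U) (representatives (induced G U) U≤F)))
  ... | no  U≰F = trans (cong (_*_ (+ hom F (induced G U))) (subsetWeight-> U (ℕP.≰⇒> U≰F)))
                        (trans (ℤP.*-zeroʳ (+ hom F (induced G U))) (sym (∑-isIso-> Hs small x x-invariant (induced G U) (ℕP.≰⇒> U≰F))))
  rearrange : ∀ i h s b → i * (h * (s * b)) ≡ h * i * s * b
  rearrange = solve-∀
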